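{- If $n$ is a non-negative integer, then \[ \sum_{k = 1}^n \sum_{j = 0}^{k - 1} \frac{( - 1)^j }{k - j}\binom{n}{j}^{ - 1} = \left( n + 1 \right)\left( \frac{H_{n + 1} }{n + 2} - \frac{( - 1)^n + 1}{\left( n + 2 \right)^2 } \right). \]
   Context: $H_n=\sum_{m=1}^n\frac1m$. Empty sums are $0$. -}

module Defs where

open import Data.Nat as ℕ using (ℕ; zero; suc; _∸_)
open import Data.Nat.Combinatorics using (_C_)
open import Data.Integer as ℤ using (ℤ; +_)
open import Data.Rational using (ℚ; _/_; _+_; _-_; _*_; 0ℚ; 1ℚ; -_)

-- reciprocal of a natural number as a rational; inv 0 = 0 is a junk value
-- that is never used in the statement (all arguments are ≥ 1 there)
inv : ℕ → ℚ
inv zero    = 0ℚ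
inv (suc m) = + 1 / suc m

ℕtoℚ : ℕ → ℚ
ℕtoℚ n = + n / 1

sgn : ℕ → ℚ
sgn zero    = 1ℚ
sgn (suc j) = - sgn j

sumRange : ℕ → (ℕ → ℚ) → ℚ
sumRange zero    f = 0ℚ
sumRange (suc m) f = sumRange m f + f m

-- Σ_{i=a}^{b} f i  (inclusive bounds, empty if b < a)
sumIcc : ℕ → ℕ → (ℕ → ℚ) → ℚ
sumIcc a b f = sumRange (suc b ∸ a) (λ i → f (a ℕ.+ i))

H : ℕ → ℚ
H n = sumIcc 1 n inv

lhs : ℕ → ℚ
lhs n = sumIcc 1 n (λ k → sumRange k (λ j → sgn j * inv (k ∸ j) * inv (n C j)))

rhs : ℕ → ℚ
rhs n = ℕtoℚ (suc n) * (H (suc n) * inv (suc (suc n))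
          - (sgn n + 1ℚ) * inv (suc (suc n) ℕ.* suc (suc n)))

{-# OPTIONS --safe #-}
-- Swapping the order of summation turns the left side into
-- Σ_{k ≤ n} (-1)^k H_{n-k} / C(n,k).  The reciprocal Pascal rule
-- 1/C(n,k) = (n+1)/(n+2) (1/C(n+1,k) + 1/C(n+1,k+1)) makes (-1)^k / C(n,k), and
-- (-1)^k H_{n-k} / C(n,k) up to a multiple of it, telescoping differences of the
-- corresponding terms for n+1, so both sums collapse to their boundary terms.
module Submission where

open import Defs
open import Data.Integer as ℤ using (+_)
import Data.Integer.Properties as ℤ
open import Data.List using (_∷_; [])
open import Data.Nat as ℕ using (ℕ; zero; suc; _∸_; _≤_; _<_; _>_; s≤s; NonZero; >-nonZero)
import Data.Nat.Properties as ℕ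
import Data.Nat.Tactic.RingSolver as ℕ-Ring
open import Data.Nat.Combinatorics
  using (_C_; nCk+nC[k+1]≡[n+1]C[k+1]; nCk≡nC[n∸k]; nC1≡n; nCn≡1)
open import Data.Rational using (ℚ; _/_; _+_; _-_; _*_; -_; 0ℚ; 1ℚ; toℚᵘ)
open import Data.Rational.Properties
  using ( _≟_; +-*-commutativeRing; toℚᵘ-fromℚᵘ; toℚᵘ-injective; toℚᵘ-homo-+; toℚᵘ-homo-*
        ; +-comm; +-identityʳ; +-inverseʳ; *-assoc; *-identityˡ; *-identityʳ; *-zeroˡ; *-zeroʳ
        ; *-distribˡ-+; *-distribʳ-+ )
open import Data.Rational.Unnormalised as ℚᵘ using (mkℚᵘ; *≡*)
import Data.Rational.Unnormalised.Properties as ℚᵘ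
open import Level using (0ℓ)
open import Relation.Binary.PropositionalEquality
  using (_≡_; refl; sym; trans; cong; cong₂; subst; module ≡-Reasoning)
open import Relation.Nullary.Decidable using (dec⇒maybe)
open import Tactic.RingSolver using (solve-∀; solve)
open import Tactic.RingSolver.Core.AlmostCommutativeRing
  using (AlmostCommutativeRing; fromCommutativeRing)

ℚ-ring : AlmostCommutativeRing 0ℓ 0ℓ
ℚ-ring = fromCommutativeRing +-*-commutativeRing (λ x → dec⇒maybe (0ℚ ≟ x))

k≤n⇒nCk>0 : ∀ {n k} → k ≤ n → n C k > 0
k≤n⇒nCk>0 {k = zero}  _         = ℕ.z<s
k≤n⇒nCk>0 {suc n} {suc k} (s≤s k≤n) =
  subst (_> 0) (nCk+nC[k+1]≡[n+1]C[k+1] n k) (ℕ.<-≤-trans (k≤n⇒nCk>0 k≤n) (ℕ.m≤m+n _ _))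

[k+1]*[n+1]C[k+1]≡[n+1]*nCk : ∀ n k → suc k ℕ.* (suc n C suc k) ≡ suc n ℕ.* (n C k)
[k+1]*[n+1]C[k+1]≡[n+1]*nCk zero    zero    = refl
[k+1]*[n+1]C[k+1]≡[n+1]*nCk zero    (suc k) = ℕ.*-zeroʳ (suc (suc k))
[k+1]*[n+1]C[k+1]≡[n+1]*nCk (suc n) zero    =
  trans (ℕ.*-identityˡ _) (trans (nC1≡n (suc (suc n))) (sym (ℕ.*-identityʳ (suc (suc n)))))
[k+1]*[n+1]C[k+1]≡[n+1]*nCk (suc n) (suc k) = begin
  suc (suc k) ℕ.* (suc (suc n) C suc (suc k))
    ≡⟨ cong (suc (suc k) ℕ.*_) (nCk+nC[k+1]≡[n+1]C[k+1] (suc n) (suc k)) ⟨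
  suc (suc k) ℕ.* (c₁ ℕ.+ c₂)
    ≡⟨ ℕ.*-distribˡ-+ (suc (suc k)) c₁ c₂ ⟩
  c₁ ℕ.+ suc k ℕ.* c₁ ℕ.+ suc (suc k) ℕ.* c₂
    ≡⟨ cong₂ (λ x y → c₁ ℕ.+ x ℕ.+ y) ([k+1]*[n+1]C[k+1]≡[n+1]*nCk n k) ([k+1]*[n+1]C[k+1]≡[n+1]*nCk n (suc k)) ⟩
  c₁ ℕ.+ suc n ℕ.* (n C k) ℕ.+ suc n ℕ.* (n C suc k)
    ≡⟨ ℕ.+-assoc c₁ _ _ ⟩
  c₁ ℕ.+ (suc n ℕ.* (n C k) ℕ.+ suc n ℕ.* (n C suc k))
    ≡⟨ cong (c₁ ℕ.+_) (ℕ.*-distribˡ-+ (suc n) (n C k) (n C suc k)) ⟨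
  c₁ ℕ.+ suc n ℕ.* (n C k ℕ.+ n C suc k)
    ≡⟨ cong (λ x → c₁ ℕ.+ suc n ℕ.* x) (nCk+nC[k+1]≡[n+1]C[k+1] n k) ⟩
  suc (suc n) ℕ.* c₁ ∎
  where
  open ≡-Reasoning
  c₁ c₂ : ℕ
  c₁ = suc n C suc k
  c₂ = suc n C suc (suc k)

[n+1-k]*[n+1]Ck≡[n+1]*nCk : ∀ {n k} → k ≤ n → (suc n ∸ k) ℕ.* (suc n C k) ≡ suc n ℕ.* (n C k)
[n+1-k]*[n+1]Ck≡[n+1]*nCk {n} {k} k≤n = begin
  (suc n ∸ k) ℕ.* (suc n C k)            ≡⟨ cong ((suc n ∸ k) ℕ.*_) (nCk≡nC[n∸k] (ℕ.m≤n⇒m≤1+n k≤n)) ⟩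
  (suc n ∸ k) ℕ.* (suc n C (suc n ∸ k))  ≡⟨ cong (λ i → i ℕ.* (suc n C i)) (ℕ.+-∸-assoc 1 k≤n) ⟩
  suc (n ∸ k) ℕ.* (suc n C suc (n ∸ k))  ≡⟨ [k+1]*[n+1]C[k+1]≡[n+1]*nCk n (n ∸ k) ⟩
  suc n ℕ.* (n C (n ∸ k))                ≡⟨ cong (suc n ℕ.*_) (nCk≡nC[n∸k] k≤n) ⟨
  suc n ℕ.* (n C k)                      ∎
  where open ≡-Reasoning

nCk-reciprocal-pascal : ∀ n k →
  suc (suc n) ℕ.* ((suc n C k) ℕ.* (suc n C suc k)) ≡ suc n ℕ.* (suc n C k ℕ.+ suc n C suc k) ℕ.* (n C k)
nCk-reciprocal-pascal n k = ℕ.*-cancelˡ-≡ _ _ (suc k) (multiply-out (suc k) (suc (suc n)) (suc n) (n C k) (suc n C k) (suc n C suc k)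
  ([k+1]*[n+1]C[k+1]≡[n+1]*nCk n k)
  (trans (cong (suc k ℕ.*_) (nCk+nC[k+1]≡[n+1]C[k+1] (suc n) k)) ([k+1]*[n+1]C[k+1]≡[n+1]*nCk (suc n) k)))
  where
  open ≡-Reasoning
  multiply-out : ∀ x q p a b c → x ℕ.* c ≡ p ℕ.* a → x ℕ.* (b ℕ.+ c) ≡ q ℕ.* b →
                 x ℕ.* (q ℕ.* (b ℕ.* c)) ≡ x ℕ.* (p ℕ.* (b ℕ.+ c) ℕ.* a)
  multiply-out x q p a b c xc≡pa x[b+c]≡qb = begin
    x ℕ.* (q ℕ.* (b ℕ.* c))      ≡⟨ ℕ-Ring.solve (x ∷ q ∷ b ∷ c ∷ []) ⟩
    q ℕ.* b ℕ.* (x ℕ.* c)        ≡⟨ cong (q ℕ.* b ℕ.*_) xc≡pa ⟩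
    q ℕ.* b ℕ.* (p ℕ.* a)        ≡⟨ ℕ-Ring.solve (q ∷ b ∷ p ∷ a ∷ []) ⟩
    p ℕ.* a ℕ.* (q ℕ.* b)        ≡⟨ cong (p ℕ.* a ℕ.*_) x[b+c]≡qb ⟨
    p ℕ.* a ℕ.* (x ℕ.* (b ℕ.+ c))  ≡⟨ ℕ-Ring.solve (p ∷ a ∷ x ∷ b ∷ c ∷ []) ⟩
    x ℕ.* (p ℕ.* (b ℕ.+ c) ℕ.* a)  ∎

-- Facts about ℕtoℚ and inv are checked in ℚᵘ, where i / suc d is literally mkℚᵘ i d.
toℚᵘ-/ : ∀ i d → toℚᵘ (i / suc d) ℚᵘ.≃ mkℚᵘ i d
toℚᵘ-/ i d = toℚᵘ-fromℚᵘ (mkℚᵘ i d)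

ℕtoℚ-homo-+ : ∀ m n → ℕtoℚ (m ℕ.+ n) ≡ ℕtoℚ m + ℕtoℚ n
ℕtoℚ-homo-+ m n = toℚᵘ-injective (begin
  toℚᵘ (ℕtoℚ (m ℕ.+ n))             ≈⟨ toℚᵘ-/ (+ (m ℕ.+ n)) 0 ⟩
  mkℚᵘ (+ (m ℕ.+ n)) 0              ≈⟨ *≡* (cong (ℤ._* + 1) (trans (ℤ.pos-+ m n)
                                         (sym (cong₂ ℤ._+_ (ℤ.*-identityʳ (+ m)) (ℤ.*-identityʳ (+ n)))))) ⟩
  mkℚᵘ (+ m) 0 ℚᵘ.+ mkℚᵘ (+ n) 0    ≈⟨ ℚᵘ.+-cong (toℚᵘ-/ (+ m) 0) (toℚᵘ-/ (+ n) 0) ⟨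
  toℚᵘ (ℕtoℚ m) ℚᵘ.+ toℚᵘ (ℕtoℚ n)  ≈⟨ toℚᵘ-homo-+ (ℕtoℚ m) (ℕtoℚ n) ⟨
  toℚᵘ (ℕtoℚ m + ℕtoℚ n)            ∎)
  where open ℚᵘ.≃-Reasoning

ℕtoℚ-homo-* : ∀ m n → ℕtoℚ (m ℕ.* n) ≡ ℕtoℚ m * ℕtoℚ n
ℕtoℚ-homo-* m n = toℚᵘ-injective (begin
  toℚᵘ (ℕtoℚ (m ℕ.* n))             ≈⟨ toℚᵘ-/ (+ (m ℕ.* n)) 0 ⟩
  mkℚᵘ (+ (m ℕ.* n)) 0              ≈⟨ *≡* (cong (ℤ._* + 1) (ℤ.pos-* m n)) ⟩
  mkℚᵘ (+ m) 0 ℚᵘ.* mkℚᵘ (+ n) 0    ≈⟨ ℚᵘ.*-cong (toℚᵘ-/ (+ m) 0) (toℚᵘ-/ (+ n) 0) ⟨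
  toℚᵘ (ℕtoℚ m) ℚᵘ.* toℚᵘ (ℕtoℚ n)  ≈⟨ toℚᵘ-homo-* (ℕtoℚ m) (ℕtoℚ n) ⟨
  toℚᵘ (ℕtoℚ m * ℕtoℚ n)            ∎)
  where open ℚᵘ.≃-Reasoning

inv-homo-* : ∀ m n → inv (m ℕ.* n) ≡ inv m * inv n
inv-homo-* zero    n       = sym (*-zeroˡ (inv n))
inv-homo-* (suc m) zero    = trans (cong inv (ℕ.*-zeroʳ m)) (sym (*-zeroʳ (inv (suc m))))
inv-homo-* (suc m) (suc n) = toℚᵘ-injective (begin
  toℚᵘ (inv (suc m ℕ.* suc n))                ≈⟨ toℚᵘ-/ (+ 1) (ℕ.pred (suc m ℕ.* suc n)) ⟩
  mkℚᵘ (+ 1) m ℚᵘ.* mkℚᵘ (+ 1) n              ≈⟨ ℚᵘ.*-cong (toℚᵘ-/ (+ 1) m) (toℚᵘ-/ (+ 1) n) ⟨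
  toℚᵘ (inv (suc m)) ℚᵘ.* toℚᵘ (inv (suc n))  ≈⟨ toℚᵘ-homo-* (inv (suc m)) (inv (suc n)) ⟨
  toℚᵘ (inv (suc m) * inv (suc n))            ∎)
  where open ℚᵘ.≃-Reasoning

ℕtoℚ-*-inv : ∀ m .{{_ : NonZero m}} → ℕtoℚ m * inv m ≡ 1ℚ
ℕtoℚ-*-inv (suc m) = toℚᵘ-injective (begin
  toℚᵘ (ℕtoℚ (suc m) * inv (suc m))            ≈⟨ toℚᵘ-homo-* (ℕtoℚ (suc m)) (inv (suc m)) ⟩
  toℚᵘ (ℕtoℚ (suc m)) ℚᵘ.* toℚᵘ (inv (suc m))  ≈⟨ ℚᵘ.*-cong (toℚᵘ-/ (+ suc m) 0) (toℚᵘ-/ (+ 1) m) ⟩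
  mkℚᵘ (+ suc m) 0 ℚᵘ.* mkℚᵘ (+ 1) m          ≈⟨ ℚᵘ.*-inverseʳ (mkℚᵘ (+ suc m) 0) ⟩
  ℚᵘ.1ℚᵘ                                      ∎)
  where open ℚᵘ.≃-Reasoning

ℕtoℚ-*-inv-cancelˡ : ∀ m k .{{_ : NonZero m}} → ℕtoℚ m * inv (m ℕ.* k) ≡ inv k
ℕtoℚ-*-inv-cancelˡ m k = begin
  ℕtoℚ m * inv (m ℕ.* k)    ≡⟨ cong (ℕtoℚ m *_) (inv-homo-* m k) ⟩
  ℕtoℚ m * (inv m * inv k)  ≡⟨ *-assoc (ℕtoℚ m) (inv m) (inv k) ⟨
  ℕtoℚ m * inv m * inv k    ≡⟨ cong (_* inv k) (ℕtoℚ-*-inv m) ⟩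
  1ℚ * inv k                ≡⟨ *-identityˡ (inv k) ⟩
  inv k                     ∎
  where open ≡-Reasoning

inv-+-inv : ∀ b c .{{_ : NonZero b}} .{{_ : NonZero c}} → inv b + inv c ≡ ℕtoℚ (b ℕ.+ c) * inv (b ℕ.* c)
inv-+-inv b c = begin
  inv b + inv c                                    ≡⟨ cong₂ _+_ (ℕtoℚ-*-inv-cancelˡ c b) (ℕtoℚ-*-inv-cancelˡ b c) ⟨
  ℕtoℚ c * inv (c ℕ.* b) + ℕtoℚ b * inv (b ℕ.* c)  ≡⟨ cong (λ x → ℕtoℚ c * inv x + ℕtoℚ b * inv (b ℕ.* c)) (ℕ.*-comm c b) ⟩
  ℕtoℚ c * inv (b ℕ.* c) + ℕtoℚ b * inv (b ℕ.* c)  ≡⟨ *-distribʳ-+ (inv (b ℕ.* c)) (ℕtoℚ c) (ℕtoℚ b) ⟨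
  (ℕtoℚ c + ℕtoℚ b) * inv (b ℕ.* c)                ≡⟨ cong (_* inv (b ℕ.* c)) (trans (+-comm (ℕtoℚ c) (ℕtoℚ b)) (sym (ℕtoℚ-homo-+ b c))) ⟩
  ℕtoℚ (b ℕ.+ c) * inv (b ℕ.* c)                   ∎
  where open ≡-Reasoning

ρ : ℕ → ℚ
ρ n = ℕtoℚ (suc n) * inv (suc (suc n))

inv-nCk-reciprocal-pascal : ∀ {n k} → k ≤ n → inv (n C k) ≡ ρ n * (inv (suc n C k) + inv (suc n C suc k))
inv-nCk-reciprocal-pascal {n} {k} k≤n = sym (begin
  ℕtoℚ p * inv q * (inv b + inv c)                      ≡⟨ cong (ℕtoℚ p * inv q *_) (inv-+-inv b c) ⟩
  ℕtoℚ p * inv q * (ℕtoℚ (b ℕ.+ c) * inv (b ℕ.* c))     ≡⟨ interchange (ℕtoℚ p) (inv q) (ℕtoℚ (b ℕ.+ c)) (inv (b ℕ.* c)) ⟩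
  ℕtoℚ p * ℕtoℚ (b ℕ.+ c) * (inv q * inv (b ℕ.* c))     ≡⟨ cong₂ _*_ (ℕtoℚ-homo-* p (b ℕ.+ c)) (inv-homo-* q (b ℕ.* c)) ⟨
  ℕtoℚ (p ℕ.* (b ℕ.+ c)) * inv (q ℕ.* (b ℕ.* c))        ≡⟨ cong (λ x → ℕtoℚ (p ℕ.* (b ℕ.+ c)) * inv x) (nCk-reciprocal-pascal n k) ⟩
  ℕtoℚ (p ℕ.* (b ℕ.+ c)) * inv (p ℕ.* (b ℕ.+ c) ℕ.* a)  ≡⟨ ℕtoℚ-*-inv-cancelˡ (p ℕ.* (b ℕ.+ c)) a ⟩
  inv a                                                 ∎)
  where
  open ≡-Reasoning
  p q a b c : ℕ
  p = suc n
  q = suc (suc n)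
  a = n C k
  b = suc n C k
  c = suc n C suc k
  interchange : ∀ w x y z → w * x * (y * z) ≡ w * y * (x * z)
  interchange = solve-∀ ℚ-ring
  instance
    b≢0 : NonZero b
    b≢0 = >-nonZero (k≤n⇒nCk>0 (ℕ.m≤n⇒m≤1+n k≤n))
    c≢0 : NonZero c
    c≢0 = >-nonZero (k≤n⇒nCk>0 (s≤s k≤n))
    p[b+c]≢0 : NonZero (p ℕ.* (b ℕ.+ c))
    p[b+c]≢0 = ℕ.m*n≢0 p (b ℕ.+ c) {{_}} {{>-nonZero (ℕ.<-≤-trans (k≤n⇒nCk>0 (ℕ.m≤n⇒m≤1+n k≤n)) (ℕ.m≤m+n b c))}}

sumRange-cong : ∀ m {f g : ℕ → ℚ} → (∀ {j} → j < m → f j ≡ g j) → sumRange m f ≡ sumRange m g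
sumRange-cong zero    _   = refl
sumRange-cong (suc m) f≈g = cong₂ _+_ (sumRange-cong m (λ j<m → f≈g (ℕ.m<n⇒m<1+n j<m))) (f≈g (ℕ.n<1+n m))

sumRange-+ : ∀ m (f g : ℕ → ℚ) → sumRange m (λ j → f j + g j) ≡ sumRange m f + sumRange m g
sumRange-+ zero    f g = refl
sumRange-+ (suc m) f g = trans (cong (_+ (f m + g m)) (sumRange-+ m f g))
  (interchange (sumRange m f) (sumRange m g) (f m) (g m))
  where
  interchange : ∀ a b c d → a + b + (c + d) ≡ a + c + (b + d)
  interchange = solve-∀ ℚ-ring

sumRange-- : ∀ m (f g : ℕ → ℚ) → sumRange m (λ j → f j - g j) ≡ sumRange m f - sumRange m g
sumRange-- zero    f g = refl
sumRange-- (suc m) f g = trans (cong (_+ (f m - g m)) (sumRange-- m f g))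
  (interchange (sumRange m f) (sumRange m g) (f m) (g m))
  where
  interchange : ∀ a b c d → a - b + (c - d) ≡ a + c - (b + d)
  interchange = solve-∀ ℚ-ring

sumRange-*ˡ : ∀ m c (f : ℕ → ℚ) → sumRange m (λ j → c * f j) ≡ c * sumRange m f
sumRange-*ˡ zero    c f = sym (*-zeroʳ c)
sumRange-*ˡ (suc m) c f =
  trans (cong (_+ (c * f m)) (sumRange-*ˡ m c f)) (sym (*-distribˡ-+ c (sumRange m f) (f m)))

sumRange-telescope : ∀ m (φ : ℕ → ℚ) → sumRange m (λ j → φ j - φ (suc j)) ≡ φ 0 - φ m
sumRange-telescope zero    φ = sym (+-inverseʳ (φ 0))
sumRange-telescope (suc m) φ =
  trans (cong (_+ (φ m - φ (suc m))) (sumRange-telescope m φ)) (cancel (φ 0) (φ m) (φ (suc m)))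
  where
  cancel : ∀ a b c → a - b + (b - c) ≡ a - c
  cancel = solve-∀ ℚ-ring

sumRange-suc-0 : ∀ m (f : ℕ → ℚ) → f m ≡ 0ℚ → sumRange (suc m) f ≡ sumRange m f
sumRange-suc-0 m f fm≡0 = trans (cong (_+_ (sumRange m f)) fm≡0) (+-identityʳ (sumRange m f))

H-suc-∸ : ∀ {m j} → j ≤ m → H (suc m ∸ j) ≡ H (m ∸ j) + inv (suc m ∸ j)
H-suc-∸ {m} {j} j≤m = trans (cong H 1+m-j≡) (cong (λ i → H (m ∸ j) + inv i) (sym 1+m-j≡))
  where
  1+m-j≡ : suc m ∸ j ≡ suc (m ∸ j)
  1+m-j≡ = ℕ.+-∸-assoc 1 j≤m

x*H[m∸m]≡0 : ∀ x m → x * H (m ∸ m) ≡ 0ℚ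
x*H[m∸m]≡0 x m = trans (cong (λ i → x * H i) (ℕ.n∸n≡0 m)) (*-zeroʳ x)

sumRange-interchange-harmonic : ∀ (w : ℕ → ℚ) m →
  sumRange m (λ i → sumRange (suc i) (λ j → w j * inv (suc i ∸ j))) ≡ sumRange m (λ j → w j * H (m ∸ j))
sumRange-interchange-harmonic w zero    = refl
sumRange-interchange-harmonic w (suc m) = begin
  sumRange m (λ i → sumRange (suc i) (λ j → w j * inv (suc i ∸ j))) + newest
    ≡⟨ cong (_+ newest) (sumRange-interchange-harmonic w m) ⟩
  sumRange m (λ j → w j * H (m ∸ j)) + newest
    ≡⟨ cong (_+ newest) (sumRange-suc-0 m (λ j → w j * H (m ∸ j)) (x*H[m∸m]≡0 (w m) m)) ⟨
  sumRange (suc m) (λ j → w j * H (m ∸ j)) + newest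
    ≡⟨ sumRange-+ (suc m) (λ j → w j * H (m ∸ j)) (λ j → w j * inv (suc m ∸ j)) ⟨
  sumRange (suc m) (λ j → w j * H (m ∸ j) + w j * inv (suc m ∸ j))
    ≡⟨ sumRange-cong (suc m) merge ⟩
  sumRange (suc m) (λ j → w j * H (suc m ∸ j))
    ∎
  where
  open ≡-Reasoning
  newest : ℚ
  newest = sumRange (suc m) (λ j → w j * inv (suc m ∸ j))
  merge : ∀ {j} → j < suc m → w j * H (m ∸ j) + w j * inv (suc m ∸ j) ≡ w j * H (suc m ∸ j)
  merge {j} (s≤s j≤m) = trans (sym (*-distribˡ-+ (w j) _ _)) (cong (w j *_) (sym (H-suc-∸ j≤m)))

altInvBinomial : ℕ → ℕ → ℚ
altInvBinomial n k = sgn k * inv (n C k)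

altInvBinomialH : ℕ → ℕ → ℚ
altInvBinomialH n k = altInvBinomial n k * H (n ∸ k)

altInvBinomial-telescopes : ∀ {n k} → k ≤ n →
  altInvBinomial n k ≡ ρ n * (altInvBinomial (suc n) k - altInvBinomial (suc n) (suc k))
altInvBinomial-telescopes {n} {k} k≤n = begin
  sgn k * inv (n C k)
    ≡⟨ cong (sgn k *_) (inv-nCk-reciprocal-pascal k≤n) ⟩
  sgn k * (ρ n * (inv (suc n C k) + inv (suc n C suc k)))
    ≡⟨ distribute (sgn k) (ρ n) (inv (suc n C k)) (inv (suc n C suc k)) ⟩
  ρ n * (sgn k * inv (suc n C k) - (- sgn k) * inv (suc n C suc k))
    ∎
  where
  open ≡-Reasoning
  distribute : ∀ s r x y → s * (r * (x + y)) ≡ r * (s * x - (- s) * y)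
  distribute = solve-∀ ℚ-ring

sum-altInvBinomial : ∀ n → sumRange (suc n) (altInvBinomial n) ≡ ρ n * (sgn n + 1ℚ)
sum-altInvBinomial n = begin
  sumRange (suc n) (altInvBinomial n)
    ≡⟨ sumRange-cong (suc n) telescopes ⟩
  sumRange (suc n) (λ k → ρ n * (altInvBinomial (suc n) k - altInvBinomial (suc n) (suc k)))
    ≡⟨ sumRange-*ˡ (suc n) (ρ n) _ ⟩
  ρ n * sumRange (suc n) (λ k → altInvBinomial (suc n) k - altInvBinomial (suc n) (suc k))
    ≡⟨ cong (ρ n *_) (sumRange-telescope (suc n) (altInvBinomial (suc n))) ⟩
  ρ n * (1ℚ * 1ℚ - (- sgn n) * inv (suc n C suc n))
    ≡⟨ cong (λ c → ρ n * (1ℚ * 1ℚ - (- sgn n) * inv c)) (nCn≡1 (suc n)) ⟩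
  ρ n * (1ℚ * 1ℚ - (- sgn n) * 1ℚ)
    ≡⟨ simplify (ρ n) (sgn n) ⟩
  ρ n * (sgn n + 1ℚ)
    ∎
  where
  open ≡-Reasoning
  telescopes : ∀ {k} → k < suc n →
    altInvBinomial n k ≡ ρ n * (altInvBinomial (suc n) k - altInvBinomial (suc n) (suc k))
  telescopes (s≤s k≤n) = altInvBinomial-telescopes k≤n
  simplify : ∀ r s → r * (1ℚ * 1ℚ - (- s) * 1ℚ) ≡ r * (s + 1ℚ)
  simplify = solve-∀ ℚ-ring

ρ*inv[n+1]≡inv[n+2] : ∀ n → ρ n * inv (suc n) ≡ inv (suc (suc n))
ρ*inv[n+1]≡inv[n+2] n = begin
  ℕtoℚ (suc n) * inv (suc (suc n)) * inv (suc n)  ≡⟨ rotate (ℕtoℚ (suc n)) (inv (suc (suc n))) (inv (suc n)) ⟩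
  inv (suc (suc n)) * (ℕtoℚ (suc n) * inv (suc n))  ≡⟨ cong (inv (suc (suc n)) *_) (ℕtoℚ-*-inv (suc n)) ⟩
  inv (suc (suc n)) * 1ℚ                          ≡⟨ *-identityʳ (inv (suc (suc n))) ⟩
  inv (suc (suc n))                               ∎
  where
  open ≡-Reasoning
  rotate : ∀ x y z → x * y * z ≡ y * (x * z)
  rotate = solve-∀ ℚ-ring

altInvBinomialH-telescopes : ∀ {n k} → k ≤ n →
  altInvBinomialH n k ≡ ρ n * (altInvBinomialH (suc n) k - altInvBinomialH (suc n) (suc k))
                        - inv (suc (suc n)) * altInvBinomial n k
altInvBinomialH-telescopes {n} {k} k≤n =
  trans (combine (ρ n) (sgn k) a b c h i r q (altInvBinomial-telescopes k≤n) i*b≡r*a (ρ*inv[n+1]≡inv[n+2] n))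
        (cong (λ x → ρ n * (sgn k * b * x - (- sgn k) * c * h) - q * (sgn k * a)) (sym (H-suc-∸ k≤n)))
  where
  open ≡-Reasoning
  a b c h i r q : ℚ
  a = inv (n C k)
  b = inv (suc n C k)
  c = inv (suc n C suc k)
  h = H (n ∸ k)
  i = inv (suc n ∸ k)
  r = inv (suc n)
  q = inv (suc (suc n))
  i*b≡r*a : i * b ≡ r * a
  i*b≡r*a = begin
    inv (suc n ∸ k) * inv (suc n C k)   ≡⟨ inv-homo-* (suc n ∸ k) (suc n C k) ⟨
    inv ((suc n ∸ k) ℕ.* (suc n C k))  ≡⟨ cong inv ([n+1-k]*[n+1]Ck≡[n+1]*nCk k≤n) ⟩
    inv (suc n ℕ.* (n C k))            ≡⟨ inv-homo-* (suc n) (n C k) ⟩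
    inv (suc n) * inv (n C k)          ∎
  combine : ∀ P s a b c h i r q → s * a ≡ P * (s * b - (- s) * c) → i * b ≡ r * a → P * r ≡ q →
            s * a * h ≡ P * (s * b * (h + i) - (- s) * c * h) - q * (s * a)
  combine P s a b c h i r q telescopes i*b≡r*a P*r≡q = sym (begin
    P * (s * b * (h + i) - (- s) * c * h) - q * (s * a)
      ≡⟨ solve (P ∷ s ∷ a ∷ b ∷ c ∷ h ∷ i ∷ q ∷ []) ℚ-ring ⟩
    P * (s * b - (- s) * c) * h + s * (P * (i * b)) - q * (s * a)
      ≡⟨ cong₂ (λ x y → x * h + s * (P * y) - q * (s * a)) (sym telescopes) i*b≡r*a ⟩
    s * a * h + s * (P * (r * a)) - q * (s * a)
      ≡⟨ solve (P ∷ s ∷ a ∷ h ∷ r ∷ q ∷ []) ℚ-ring ⟩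
    s * a * h + P * r * (s * a) - q * (s * a)
      ≡⟨ cong (λ x → s * a * h + x * (s * a) - q * (s * a)) P*r≡q ⟩
    s * a * h + q * (s * a) - q * (s * a)
      ≡⟨ solve (s ∷ a ∷ h ∷ q ∷ []) ℚ-ring ⟩
    s * a * h
      ∎)

lhs≡sum-altInvBinomialH : ∀ n → lhs n ≡ sumRange n (altInvBinomialH n)
lhs≡sum-altInvBinomialH n = trans
  (sumRange-cong n (λ {i} _ → sumRange-cong (suc i) (λ {j} _ → swap (sgn j) (inv (suc i ∸ j)) (inv (n C j)))))
  (sumRange-interchange-harmonic (altInvBinomial n) n)
  where
  swap : ∀ x y z → x * y * z ≡ x * z * y
  swap = solve-∀ ℚ-ring

proposition22 : (n : ℕ) → lhs n ≡ rhs n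
proposition22 n = begin
  lhs n
    ≡⟨ lhs≡sum-altInvBinomialH n ⟩
  sumRange n (altInvBinomialH n)
    ≡⟨ sumRange-suc-0 n (altInvBinomialH n) (x*H[m∸m]≡0 (altInvBinomial n n) n) ⟨
  sumRange (suc n) (altInvBinomialH n)
    ≡⟨ sumRange-cong (suc n) telescopes ⟩
  sumRange (suc n) (λ k → ρ n * (φ k - φ (suc k)) - q * altInvBinomial n k)
    ≡⟨ sumRange-- (suc n) (λ k → ρ n * (φ k - φ (suc k))) (λ k → q * altInvBinomial n k) ⟩
  sumRange (suc n) (λ k → ρ n * (φ k - φ (suc k))) - sumRange (suc n) (λ k → q * altInvBinomial n k)
    ≡⟨ cong₂ _-_ (trans (sumRange-*ˡ (suc n) (ρ n) _) (cong (ρ n *_) (sumRange-telescope (suc n) φ)))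
                 (trans (sumRange-*ˡ (suc n) q _) (cong (q *_) (sum-altInvBinomial n))) ⟩
  ρ n * (1ℚ * 1ℚ * H (suc n) - φ (suc n)) - q * (ρ n * (sgn n + 1ℚ))
    ≡⟨ cong (λ x → ρ n * (1ℚ * 1ℚ * H (suc n) - x) - q * (ρ n * (sgn n + 1ℚ))) (x*H[m∸m]≡0 (altInvBinomial (suc n) (suc n)) (suc n)) ⟩
  ρ n * (1ℚ * 1ℚ * H (suc n) - 0ℚ) - q * (ρ n * (sgn n + 1ℚ))
    ≡⟨ simplify (ℕtoℚ (suc n)) q (H (suc n)) (sgn n) ⟩
  ℕtoℚ (suc n) * (H (suc n) * q - (sgn n + 1ℚ) * (q * q))
    ≡⟨ cong (λ x → ℕtoℚ (suc n) * (H (suc n) * q - (sgn n + 1ℚ) * x)) (inv-homo-* (suc (suc n)) (suc (suc n))) ⟨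
  rhs n
    ∎
  where
  open ≡-Reasoning
  φ : ℕ → ℚ
  φ = altInvBinomialH (suc n)
  q : ℚ
  q = inv (suc (suc n))
  telescopes : ∀ {k} → k < suc n → altInvBinomialH n k ≡ ρ n * (φ k - φ (suc k)) - q * altInvBinomial n k
  telescopes (s≤s k≤n) = altInvBinomialH-telescopes k≤n
  simplify : ∀ p q h s → p * q * (1ℚ * 1ℚ * h - 0ℚ) - q * (p * q * (s + 1ℚ)) ≡ p * (h * q - (s + 1ℚ) * (q * q))
  simplify = solve-∀ ℚ-ring
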